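{- Let $\psi:\mathbb Z^r\times\mathbb Z^r\to\mu_\infty$ be a bicharacter, $E=(e_1,\dots,e_r)$ a basis of $\mathbb Z^r$, and $\zeta$ a root of unity of even order $n$ such that every value of $\psi$ is a power of $\zeta$. Fix $i$ and assume $\psi(e_i,e_i)=-1$. Write $M=M^{\psi,E,\zeta}$. Then: (1) for all $j\ne i$, $m_{ij}=0$ if $M_{ij}=0$ and $m_{ij}=1$ if $M_{ij}\ne0$; (2) $M^{\psi,s_{i,E}(E),\zeta}\equiv\tau_i(M)\pmod n$ entrywise.
   Context: $\psi$ is multiplicative in each variable. For $j\ne i$, $m_{ij}=\min\{m\ge0:\psi(e_i,e_i)^{m+1}=1\text{ or }\psi(e_i,e_i)^m\psi(e_i,e_j)\psi(e_j,e_i)=1\}$; $s_{i,E}$ is the linear map with $s_{i,E}(e_i)=-e_i$, $s_{i,E}(e_j)=e_j+m_{ij}e_i$, and $s_{i,E}(E)=(s_{i,E}(e_1),\dots,s_{i,E}(e_r))$. For a basis $E'=(e'_1,\dots,e'_r)$, $M^{\psi,E',\zeta}_{jk}$ is the least nonnegative $m$ with $\zeta^m=\psi(e'_j,e'_k)\psi(e'_k,e'_j)$ if $j\ne k$ and $\zeta^m=-\psi(e'_j,e'_j)$ if $j=k$. For a symmetric integer matrix $M$ with $M_{ii}=0$, set $e_{ij}=1$ if $M_{ij}\ne0$ and $e_{ij}=0$ otherwise, and define $\tau_i(M)$ by $\tau_i(M)_{ii}=0$; $\tau_i(M)_{ij}=\tau_i(M)_{ji}=-M_{ij}$ for $j\ne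 i$; $\tau_i(M)_{jj}=M_{jj}+e_{ij}(M_{ij}+\frac n2)$ for $j\ne i$; $\tau_i(M)_{hj}=M_{hj}+e_{ih}e_{ij}(M_{ih}+M_{ij})$ for $h\ne j$, both $\ne i$. -}

module Defs where

open import Level using (Level; _⊔_)
open import Data.Nat as ℕ using (ℕ; zero; suc; _<_)
open import Data.Integer as ℤ using (ℤ; +_)
open import Data.Fin using (Fin; zero; suc; _≟_)
open import Data.Vec as Vec using (Vec)
open import Data.Product using (_×_; Σ; ∃)
open import Data.Sum using (_⊎_)
open import Relation.Nullary using (¬_; yes; no)
open import Relation.Binary.PropositionalEquality using (_≡_)
open import Algebra.Bundles using (CommutativeRing)
open import Data.Integer.Divisibility as ℤD using ()

ℤ^ : ℕ → Set
ℤ^ r = Vec ℤ r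

_⊕_ : ∀ {r} → ℤ^ r → ℤ^ r → ℤ^ r
_⊕_ = Vec.zipWith ℤ._+_

_·v_ : ∀ {r} → ℤ → ℤ^ r → ℤ^ r
a ·v v = Vec.map (a ℤ.*_) v

⊖_ : ∀ {r} → ℤ^ r → ℤ^ r
⊖ v = Vec.map ℤ.-_ v

zeroV : ∀ {r} → ℤ^ r
zeroV = Vec.replicate _ (+ 0)

lincomb : ∀ {r s} → (Fin s → ℤ) → (Fin s → ℤ^ r) → ℤ^ r
lincomb {s = zero}  c E = zeroV
lincomb {s = suc s} c E = (c zero ·v E zero) ⊕ lincomb (λ k → c (suc k)) (λ k → E (suc k))

IsBasis : ∀ {r} → (Fin r → ℤ^ r) → Set
IsBasis {r} E =
  (∀ v → Σ (Fin r → ℤ) λ c → lincomb c E ≡ v) ×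
  (∀ c c' → lincomb c E ≡ lincomb c' E → ∀ k → c k ≡ c' k)

IsLeast : ∀ {p} → (ℕ → Set p) → ℕ → Set p
IsLeast P m = P m × (∀ m' → m' < m → ¬ P m')

_≡_[mod_] : ℤ → ℤ → ℕ → Set
a ≡ b [mod n ] = (+ n) ℤD.∣ (a ℤ.- b)

module _ {c ℓ : Level} (R : CommutativeRing c ℓ) where
  open CommutativeRing R

  pow : Carrier → ℕ → Carrier
  pow x zero    = 1#
  pow x (suc k) = x * pow x k

  -- integral domain (no zero divisors); μ_∞ = roots of unity in R
  NoZeroDivisors : Set (c ⊔ ℓ)
  NoZeroDivisors = ∀ x y → x * y ≈ 0# → x ≈ 0# ⊎ y ≈ 0#

  HasOrder : Carrier → ℕ → Set ℓ
  HasOrder ζ n = (0 < n) × pow ζ n ≈ 1# × (∀ k → 0 < k → k < n → ¬ (pow ζ k ≈ 1#))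

  IsBicharacter : ∀ {r} → (ℤ^ r → ℤ^ r → Carrier) → Set ℓ
  IsBicharacter ψ = (∀ x y z → ψ (x ⊕ y) z ≈ ψ x z * ψ y z) ×
                    (∀ x y z → ψ x (y ⊕ z) ≈ ψ x y * ψ x z)

  Is-m : ∀ {r} → (ℤ^ r → ℤ^ r → Carrier) → (Fin r → ℤ^ r) → Fin r → Fin r → ℕ → Set ℓ
  Is-m ψ E i j = IsLeast (λ m → pow (ψ (E i) (E i)) (suc m) ≈ 1# ⊎
                                 pow (ψ (E i) (E i)) m * (ψ (E i) (E j) * ψ (E j) (E i)) ≈ 1#)

  Is-M-entry : ∀ {r} → (ℤ^ r → ℤ^ r → Carrier) → (Fin r → ℤ^ r) → Carrier → Fin r → Fin r → ℕ → Set ℓ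
  Is-M-entry ψ E' ζ j k with j ≟ k
  ... | yes _ = IsLeast (λ m → pow ζ m ≈ - ψ (E' j) (E' j))
  ... | no  _ = IsLeast (λ m → pow ζ m ≈ ψ (E' j) (E' k) * ψ (E' k) (E' j))

  Is-M : ∀ {r} → (ℤ^ r → ℤ^ r → Carrier) → (Fin r → ℤ^ r) → Carrier → (Fin r → Fin r → ℕ) → Set ℓ
  Is-M ψ E' ζ M = ∀ j k → Is-M-entry ψ E' ζ j k (M j k)

-- s_{i,E}(E), given the numbers m_{ij} (m j = m_{ij} for j ≠ i)
s-basis : ∀ {r} → Fin r → (Fin r → ℕ) → (Fin r → ℤ^ r) → Fin r → ℤ^ r
s-basis i m E j with j ≟ i
... | yes _ = ⊖ (E i)
... | no  _ = E j ⊕ ((+ m j) ·v E i)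

edge : ℤ → ℤ
edge a with a ℤ.≟ + 0
... | yes _ = + 0
... | no  _ = + 1

τ : ∀ {r} → ℕ → Fin r → (Fin r → Fin r → ℤ) → Fin r → Fin r → ℤ
τ n i M h j with h ≟ i | j ≟ i | h ≟ j
... | yes _ | yes _ | _     = + 0
... | yes _ | no  _ | _     = ℤ.- M i j
... | no  _ | yes _ | _     = ℤ.- M h i
... | no  _ | no  _ | yes _ = M j j ℤ.+ edge (M i j) ℤ.* (M i j ℤ.+ + (n ℕ./ 2))
... | no  _ | no  _ | no  _ = M h j ℤ.+ edge (M i h) ℤ.* edge (M i j) ℤ.* (M i h ℤ.+ M i j)

{-# OPTIONS --safe #-}

-- Every value of ψ is a power of ζ, so choosing exponents gives κ with ψ(x,y) = ζ^κ(x,y); since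
-- ζ has order n, κ is bilinear modulo n. In R, ζ^(n/2) squares to 1 but is not 1, so it is -1
-- (no zero divisors). Hence, on any family of vectors, M_jk ≡ κ(e_j,e_k) + κ(e_k,e_j) for j ≠ k
-- and M_jj ≡ n/2 + κ(e_j,e_j) modulo n; and ψ(e_i,e_i) = -1 gives κ(e_i,e_i) ≡ n/2, so the
-- symmetrisation σ of κ vanishes on e_i.
-- (1) ψ(e_i,e_i)² = 1 ≠ ψ(e_i,e_i) forces m_ij ≤ 1, and m_ij = 0 exactly when
-- ψ(e_i,e_j)ψ(e_j,e_i) = 1, that is when M_ij = 0; so m_ij = e_ij.
-- (2) Expand κ and σ on the new vectors -e_i and e_j + m_ij e_i by bilinearity and simplify with
-- σ(e_i,e_i) ≡ 0, m_ij² = m_ij and m_ij M_ij = M_ij.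

module Submission where

open import Defs
open import Level using (Level; 0ℓ)
import Data.Nat
open import Data.Nat as ℕ using (ℕ; zero; suc; z<s; s<s)
import Data.Nat.Properties as ℕP
open import Data.Nat.DivMod using (_%_; _/_; m≡m%n+[m/n]*n; m%n<n; m*n/n≡m)
open import Data.Nat.Divisibility using (m%n≡0⇒n∣m) renaming (_∣_ to _ℕ∣_)
open import Data.Integer as ℤ using (ℤ; +_)
import Data.Integer.Properties as ℤP
open import Data.Integer.Tactic.RingSolver using (solve-∀)
open import Data.Integer.Divisibility.Signed
  using (_∣_; divides; ∣m∣n⇒∣m+n; ∣m⇒∣-m; ∣n⇒∣m*n; ∣ᵤ⇒∣; ∣⇒∣ᵤ)
open import Data.Fin using (Fin; _≟_)
open import Data.Vec using ([]; _∷_)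
import Data.Vec.Properties as Vec
open import Data.Product using (Σ; _×_; _,_; proj₁; proj₂)
open import Data.Sum as Sum using (_⊎_; inj₁; inj₂)
open import Function using (id; flip; _∘_)
open import Relation.Nullary using (¬_; yes; no; contradiction)
open import Relation.Binary.Bundles using (Setoid)
open import Relation.Binary.PropositionalEquality as ≡ using (_≡_; _≢_)
open import Algebra.Bundles using (CommutativeRing)

⊕-zeroV : ∀ {r} → zeroV {r} ⊕ zeroV ≡ zeroV
⊕-zeroV = Vec.zipWith-replicate ℤ._+_ (+ 0) (+ 0)

⊖-inverseˡ : ∀ {r} (x : ℤ^ r) → (⊖ x) ⊕ x ≡ zeroV
⊖-inverseˡ []      = ≡.refl
⊖-inverseˡ (a ∷ x) = ≡.cong₂ _∷_ (ℤP.+-inverseˡ a) (⊖-inverseˡ x)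

·v-zero : ∀ {r} (x : ℤ^ r) → (+ 0) ·v x ≡ zeroV
·v-zero x = Vec.map-const x (+ 0)

·v-suc : ∀ {r} a (x : ℤ^ r) → (+ suc a) ·v x ≡ x ⊕ ((+ a) ·v x)
·v-suc a []      = ≡.refl
·v-suc a (b ∷ x) = ≡.cong₂ _∷_ (ℤP.suc-* (+ a) b) (·v-suc a x)

edge-idempotent : ∀ a → edge a ℤ.* edge a ≡ edge a
edge-idempotent a with a ℤ.≟ + 0
... | yes _ = ≡.refl
... | no _  = ≡.refl

edge-absorbs : ∀ a → edge a ℤ.* a ≡ a
edge-absorbs a with a ℤ.≟ + 0
... | yes ≡.refl = ≡.refl
... | no _       = ℤP.*-identityˡ a

IsLeast-zero : ∀ {p} {P : ℕ → Set p} {k} → IsLeast P k → P 0 → k ≡ 0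
IsLeast-zero {k = zero}  _              _  = ≡.refl
IsLeast-zero {k = suc _} (_ , minimal) P0 = contradiction P0 (minimal 0 z<s)

IsLeast-one : ∀ {p} {P : ℕ → Set p} {k} → IsLeast P k → ¬ P 0 → P 1 → k ≡ 1
IsLeast-one {k = zero}        (P0 , _)      ¬P0 _  = contradiction P0 ¬P0
IsLeast-one {k = suc zero}    _             _   _  = ≡.refl
IsLeast-one {k = suc (suc _)} (_ , minimal) _   P1 = contradiction P1 (minimal 1 (s<s z<s))

module Modular (n : ℕ) where
  open import Data.Integer using (_+_; _*_; -_; _-_)
  open ≡ using (refl; cong; cong₂; subst)

  -- A record rather than a synonym for + n ∣ a - b, so that a and b are inferable from a ≋ b.
  infix 4 _≋_
  record _≋_ (a b : ℤ) : Set where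
    constructor congruent
    field n∣a-b : + n ∣ a - b

  ≋-reflexive : ∀ {a b} → a ≡ b → a ≋ b
  ≋-reflexive {a} refl = congruent (divides (+ 0) (ℤP.+-inverseʳ a))

  ≋-refl : ∀ {a} → a ≋ a
  ≋-refl = ≋-reflexive refl

  ≋-sym : ∀ {a b} → a ≋ b → b ≋ a
  ≋-sym {a} {b} (congruent n∣a-b) = congruent (subst (+ n ∣_) (flip-minus a b) (∣m⇒∣-m n∣a-b))
    where
    flip-minus : ∀ a b → - (a - b) ≡ b - a
    flip-minus = solve-∀

  ≋-trans : ∀ {a b c} → a ≋ b → b ≋ c → a ≋ c
  ≋-trans {a} {b} {c} (congruent n∣a-b) (congruent n∣b-c) =
    congruent (subst (+ n ∣_) (ℤP.+-minus-telescope a b c) (∣m∣n⇒∣m+n n∣a-b n∣b-c))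

  ≋-setoid : Setoid 0ℓ 0ℓ
  ≋-setoid = record
    { Carrier = ℤ
    ; _≈_ = _≋_
    ; isEquivalence = record { refl = ≋-refl ; sym = ≋-sym ; trans = ≋-trans }
    }

  +-cong-≋ : ∀ {a b c d} → a ≋ b → c ≋ d → a + c ≋ b + d
  +-cong-≋ {a} {b} {c} {d} (congruent n∣a-b) (congruent n∣c-d) =
    congruent (subst (+ n ∣_) (interchange a b c d) (∣m∣n⇒∣m+n n∣a-b n∣c-d))
    where
    interchange : ∀ a b c d → (a - b) + (c - d) ≡ (a + c) - (b + d)
    interchange = solve-∀

  neg-cong-≋ : ∀ {a b} → a ≋ b → - a ≋ - b
  neg-cong-≋ {a} {b} (congruent n∣a-b) = congruent (subst (+ n ∣_) (neg-minus a b) (∣m⇒∣-m n∣a-b))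
    where
    neg-minus : ∀ a b → - (a - b) ≡ - a - - b
    neg-minus = solve-∀

  *-congˡ-≋ : ∀ k {a b} → a ≋ b → k * a ≋ k * b
  *-congˡ-≋ k {a} {b} (congruent n∣a-b) =
    congruent (subst (+ n ∣_) (distrib-minus k a b) (∣n⇒∣m*n k n∣a-b))
    where
    distrib-minus : ∀ k a b → k * (a - b) ≡ k * a - k * b
    distrib-minus = solve-∀

  n≋0 : + n ≋ + 0
  n≋0 = congruent (divides (+ 1) (≡.trans (ℤP.+-identityʳ (+ n)) (≡.sym (ℤP.*-identityˡ (+ n)))))

  ≋⇒≡[mod] : ∀ {a b} → a ≋ b → a ≡ b [mod n ]
  ≋⇒≡[mod] (congruent n∣a-b) = ∣⇒∣ᵤ n∣a-b

  ∣∸⇒≋ : ∀ {a b} → a ℕ.≤ b → n ℕ∣ b ℕ.∸ a → + b ≋ + a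
  ∣∸⇒≋ {a} {b} a≤b n∣b∸a =
    congruent (∣ᵤ⇒∣ (subst (λ d → n ℕ∣ ℤ.∣ d ∣) (≡.sym difference) n∣b∸a))
    where
    difference : + b - + a ≡ + (b ℕ.∸ a)
    difference = ≡.trans (ℤP.m-n≡m⊖n b a) (ℤP.⊖-≥ a≤b)

  +-congˡ-≋ : ∀ a {b c} → b ≋ c → a + b ≋ a + c
  +-congˡ-≋ a = +-cong-≋ (≋-refl {a})

  +-congʳ-≋ : ∀ c {a b} → a ≋ b → a + c ≋ b + c
  +-congʳ-≋ c a≋b = +-cong-≋ a≋b (≋-refl {c})

  ≋-moveʳ : ∀ {a b c} → a + b ≋ c → a ≋ c - b
  ≋-moveʳ {a} {b} a+b≋c = ≋-trans (≋-reflexive (add-sub a b)) (+-congʳ-≋ (- b) a+b≋c)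
    where
    add-sub : ∀ a b → a ≡ (a + b) - b
    add-sub = solve-∀

  module _ {r : ℕ} where
    open import Relation.Binary.Reasoning.Setoid ≋-setoid

    Additive : (ℤ^ r → ℤ) → Set
    Additive f = ∀ x y → f (x ⊕ y) ≋ f x + f y

    module _ (f : ℤ^ r → ℤ) (additive : Additive f) where

      additive-zero : f zeroV ≋ + 0
      additive-zero = ≋-trans (≋-moveʳ (begin
        f zeroV + f zeroV   ≈⟨ additive zeroV zeroV ⟨
        f (zeroV ⊕ zeroV)   ≡⟨ cong f ⊕-zeroV ⟩
        f zeroV             ∎)) (≋-reflexive (ℤP.+-inverseʳ (f zeroV)))

      additive-neg : ∀ x → f (⊖ x) ≋ - f x
      additive-neg x = ≋-trans (≋-moveʳ (begin
        f (⊖ x) + f x       ≈⟨ additive (⊖ x) x ⟨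
        f ((⊖ x) ⊕ x)       ≡⟨ cong f (⊖-inverseˡ x) ⟩
        f zeroV             ≈⟨ additive-zero ⟩
        + 0                 ∎)) (≋-reflexive (ℤP.+-identityˡ (- f x)))

      additive-scale : ∀ a x → f ((+ a) ·v x) ≋ + a * f x
      additive-scale zero x = ≋-trans (≋-reflexive (cong f (·v-zero x))) additive-zero
      additive-scale (suc a) x = begin
        f ((+ suc a) ·v x)          ≡⟨ cong f (·v-suc a x) ⟩
        f (x ⊕ ((+ a) ·v x))        ≈⟨ additive x _ ⟩
        f x + f ((+ a) ·v x)        ≈⟨ +-congˡ-≋ (f x) (additive-scale a x) ⟩
        f x + + a * f x             ≡⟨ ℤP.suc-* (+ a) (f x) ⟨
        + suc a * f x               ∎

      additive-shift : ∀ a x u → f (x ⊕ ((+ a) ·v u)) ≋ f x + + a * f u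
      additive-shift a x u = ≋-trans (additive x _) (+-congˡ-≋ (f x) (additive-scale a u))

    Bilinear : (ℤ^ r → ℤ^ r → ℤ) → Set
    Bilinear B = (∀ y → Additive (λ x → B x y)) × (∀ x → Additive (B x))

    symmetrise : (ℤ^ r → ℤ^ r → ℤ) → ℤ^ r → ℤ^ r → ℤ
    symmetrise B x y = B x y + B y x

    symmetrise-comm : ∀ B x y → symmetrise B x y ≡ symmetrise B y x
    symmetrise-comm B x y = ℤP.+-comm (B x y) (B y x)

    module _ (B : ℤ^ r → ℤ^ r → ℤ) (bilinear : Bilinear B) where

      symmetrise-bilinear : Bilinear (symmetrise B)
      symmetrise-bilinear = additiveˡ , additiveʳ
        where
        middle-four : ∀ a b c d → (a + b) + (c + d) ≡ (a + c) + (b + d)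
        middle-four = solve-∀

        additiveˡ : ∀ z → Additive (λ x → symmetrise B x z)
        additiveˡ z x y = begin
          B (x ⊕ y) z + B z (x ⊕ y)
            ≈⟨ +-cong-≋ (proj₁ bilinear z x y) (proj₂ bilinear z x y) ⟩
          (B x z + B y z) + (B z x + B z y)
            ≡⟨ middle-four (B x z) (B y z) (B z x) (B z y) ⟩
          (B x z + B z x) + (B y z + B z y)
            ∎

        additiveʳ : ∀ z → Additive (symmetrise B z)
        additiveʳ z x y = begin
          symmetrise B z (x ⊕ y)               ≡⟨ symmetrise-comm B z (x ⊕ y) ⟩
          symmetrise B (x ⊕ y) z               ≈⟨ additiveˡ z x y ⟩
          symmetrise B x z + symmetrise B y z  ≡⟨ cong₂ _+_ (symmetrise-comm B x z) (symmetrise-comm B y z) ⟩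
          symmetrise B z x + symmetrise B z y  ∎

      bilinear-negˡ : ∀ x y → B (⊖ x) y ≋ - B x y
      bilinear-negˡ x y = additive-neg (λ x → B x y) (proj₁ bilinear y) x

      bilinear-negʳ : ∀ x y → B x (⊖ y) ≋ - B x y
      bilinear-negʳ x y = additive-neg (B x) (proj₂ bilinear x) y

      bilinear-shiftʳ : ∀ b x y u → B x (y ⊕ ((+ b) ·v u)) ≋ B x y + + b * B x u
      bilinear-shiftʳ b x y u = additive-shift (B x) (proj₂ bilinear x) b y u

      bilinear-shift : ∀ a b x y u →
        B (x ⊕ ((+ a) ·v u)) (y ⊕ ((+ b) ·v u)) ≋
        (B x y + + b * B x u) + + a * (B u y + + b * B u u)
      bilinear-shift a b x y u = begin
        B (x ⊕ ((+ a) ·v u)) y′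
          ≈⟨ additive-shift (λ x → B x y′) (proj₁ bilinear y′) a x u ⟩
        B x y′ + + a * B u y′
          ≈⟨ +-cong-≋ (bilinear-shiftʳ b x y u) (*-congˡ-≋ (+ a) (bilinear-shiftʳ b u y u)) ⟩
        (B x y + + b * B x u) + + a * (B u y + + b * B u u)
          ∎
        where
        y′ : ℤ^ r
        y′ = y ⊕ ((+ b) ·v u)

  -- M^{ψ,E,ζ} seen through a discrete logarithm κ of ψ; the diagonal is shifted by h = n/2
  -- because -1 = ζ^h.
  record Represents {r : ℕ} (κ : ℤ^ r → ℤ^ r → ℤ) (h : ℕ) (E : Fin r → ℤ^ r)
                    (M : Fin r → Fin r → ℕ) : Set where
    field
      diag    : ∀ j → + M j j ≋ + h + κ (E j) (E j)
      offdiag : ∀ {j k} → j ≢ k → + M j k ≋ symmetrise κ (E j) (E k)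

  module Reflection {r : ℕ} {κ : ℤ^ r → ℤ^ r → ℤ} (κ-bilinear : Bilinear κ)
                    (h : ℕ) (n≡2h : n ≡ 2 ℕ.* h)
                    (E : Fin r → ℤ^ r) (i : Fin r) (κᵢᵢ≋h : κ (E i) (E i) ≋ + h)
                    {M : Fin r → Fin r → ℕ} (M-represents : Represents κ h E M)
                    {m : Fin r → ℕ} (m≡edge : ∀ j → j ≢ i → + m j ≡ edge (+ M i j)) where
    open import Relation.Binary.Reasoning.Setoid ≋-setoid
    open Represents M-represents

    σ : ℤ^ r → ℤ^ r → ℤ
    σ = symmetrise κ

    σ-bilinear : Bilinear σ
    σ-bilinear = symmetrise-bilinear κ κ-bilinear

    u : ℤ^ r
    u = E i

    e′ : Fin r → ℤ^ r
    e′ = s-basis i m E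

    e′-i : e′ i ≡ ⊖ u
    e′-i with i ≟ i
    ... | yes _  = refl
    ... | no i≢i = contradiction refl i≢i

    e′-j : ∀ {j} → j ≢ i → e′ j ≡ E j ⊕ ((+ m j) ·v u)
    e′-j {j} j≢i with j ≟ i
    ... | yes j≡i = contradiction j≡i j≢i
    ... | no _    = refl

    h+h≋0 : + h + + h ≋ + 0
    h+h≋0 = ≋-trans (≋-reflexive (cong +_ h+h≡n)) n≋0
      where
      h+h≡n : h ℕ.+ h ≡ n
      h+h≡n = ≡.trans (cong (h ℕ.+_) (≡.sym (ℕP.+-identityʳ h))) (≡.sym n≡2h)

    σᵤᵤ≋0 : σ u u ≋ + 0
    σᵤᵤ≋0 = ≋-trans (+-cong-≋ κᵢᵢ≋h κᵢᵢ≋h) h+h≋0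

    σ≋M : ∀ {j k} → j ≢ k → σ (E j) (E k) ≋ + M j k
    σ≋M j≢k = ≋-sym (offdiag j≢k)

    M-symmetric : ∀ {j k} → j ≢ k → + M j k ≋ + M k j
    M-symmetric {j} {k} j≢k = begin
      + M j k        ≈⟨ offdiag j≢k ⟩
      σ (E j) (E k)  ≡⟨ symmetrise-comm κ (E j) (E k) ⟩
      σ (E k) (E j)  ≈⟨ σ≋M (j≢k ∘ ≡.sym) ⟩
      + M k j        ∎

    m-idempotent : ∀ {j} → j ≢ i → + m j * + m j ≡ + m j
    m-idempotent {j} j≢i =
      subst (λ b → b * b ≡ b) (≡.sym (m≡edge j j≢i)) (edge-idempotent (+ M i j))

    m-absorbs : ∀ {j} → j ≢ i → + m j * + M i j ≡ + M i j
    m-absorbs {j} j≢i =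
      subst (λ b → b * + M i j ≡ + M i j) (≡.sym (m≡edge j j≢i)) (edge-absorbs (+ M i j))

    κ-reflected-i : κ (e′ i) (e′ i) ≋ + h
    κ-reflected-i = begin
      κ (e′ i) (e′ i)   ≡⟨ cong (λ w → κ w w) e′-i ⟩
      κ (⊖ u) (⊖ u)     ≈⟨ bilinear-negˡ κ κ-bilinear u (⊖ u) ⟩
      - κ u (⊖ u)       ≈⟨ neg-cong-≋ (bilinear-negʳ κ κ-bilinear u u) ⟩
      - - κ u u         ≡⟨ ℤP.neg-involutive (κ u u) ⟩
      κ u u             ≈⟨ κᵢᵢ≋h ⟩
      + h               ∎

    σ-reflected-i : ∀ {j} → j ≢ i → σ (e′ i) (e′ j) ≋ - + M i j
    σ-reflected-i {j} j≢i = begin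
      σ (e′ i) (e′ j)              ≡⟨ cong₂ σ e′-i (e′-j j≢i) ⟩
      σ (⊖ u) (E j ⊕ (b ·v u))     ≈⟨ bilinear-negˡ σ σ-bilinear u _ ⟩
      - σ u (E j ⊕ (b ·v u))       ≈⟨ neg-cong-≋ (bilinear-shiftʳ σ σ-bilinear (m j) u (E j) u) ⟩
      - (σ u (E j) + b * σ u u)    ≈⟨ neg-cong-≋ (+-congˡ-≋ (σ u (E j)) (*-congˡ-≋ b σᵤᵤ≋0)) ⟩
      - (σ u (E j) + b * + 0)      ≡⟨ cong (λ t → - (σ u (E j) + t)) (ℤP.*-zeroʳ b) ⟩
      - (σ u (E j) + + 0)          ≡⟨ cong -_ (ℤP.+-identityʳ (σ u (E j))) ⟩
      - σ u (E j)                  ≈⟨ neg-cong-≋ (σ≋M (j≢i ∘ ≡.sym)) ⟩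
      - + M i j                    ∎
      where
      b : ℤ
      b = + m j

    κ-reflected-diag : ∀ {j} → j ≢ i → + h + κ (e′ j) (e′ j) ≋ + M j j + + m j * (+ M i j + + h)
    κ-reflected-diag {j} j≢i = begin
      + h + κ (e′ j) (e′ j)
        ≡⟨ cong (λ w → + h + κ w w) (e′-j j≢i) ⟩
      + h + κ (x ⊕ (b ·v u)) (x ⊕ (b ·v u))
        ≈⟨ +-congˡ-≋ (+ h) (bilinear-shift κ κ-bilinear (m j) (m j) x x u) ⟩
      + h + ((κ x x + b * κ x u) + b * (κ u x + b * κ u u))
        ≈⟨ +-congˡ-≋ (+ h) (+-congˡ-≋ (κ x x + b * κ x u)
                             (*-congˡ-≋ b (+-congˡ-≋ (κ u x) (*-congˡ-≋ b κᵢᵢ≋h)))) ⟩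
      + h + ((κ x x + b * κ x u) + b * (κ u x + b * + h))
        ≡⟨ collect (+ h) (κ x x) (κ x u) (κ u x) b (m-idempotent j≢i) ⟩
      (+ h + κ x x) + b * (σ u x + + h)
        ≈⟨ +-cong-≋ (≋-sym (diag j)) (*-congˡ-≋ b (+-congʳ-≋ (+ h) (σ≋M (j≢i ∘ ≡.sym)))) ⟩
      + M j j + b * (+ M i j + + h)
        ∎
      where
      x : ℤ^ r
      x = E j
      b : ℤ
      b = + m j
      collect : ∀ h xx xu ux b → b * b ≡ b →
                h + ((xx + b * xu) + b * (ux + b * h)) ≡ (h + xx) + b * ((ux + xu) + h)
      collect h xx xu ux b b²≡b = ≡.trans (expand h xx xu ux b)
        (≡.trans (cong (λ c → (h + xx) + b * (ux + xu) + c * h) b²≡b) (factor h xx xu ux b))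
        where
        expand : ∀ h xx xu ux b →
                 h + ((xx + b * xu) + b * (ux + b * h)) ≡ (h + xx) + b * (ux + xu) + (b * b) * h
        expand = solve-∀
        factor : ∀ h xx xu ux b → (h + xx) + b * (ux + xu) + b * h ≡ (h + xx) + b * ((ux + xu) + h)
        factor = solve-∀

    σ-reflected-offdiag : ∀ {a j} → a ≢ i → j ≢ i → a ≢ j →
                          σ (e′ a) (e′ j) ≋ + M a j + + m a * + m j * (+ M i a + + M i j)
    σ-reflected-offdiag {a} {j} a≢i j≢i a≢j = begin
      σ (e′ a) (e′ j)
        ≡⟨ cong₂ σ (e′-j a≢i) (e′-j j≢i) ⟩
      σ (x ⊕ (α ·v u)) (y ⊕ (β ·v u))
        ≈⟨ bilinear-shift σ σ-bilinear (m a) (m j) x y u ⟩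
      (σ x y + β * σ x u) + α * (σ u y + β * σ u u)
        ≈⟨ +-congˡ-≋ (σ x y + β * σ x u)
                     (*-congˡ-≋ α (+-congˡ-≋ (σ u y) (*-congˡ-≋ β σᵤᵤ≋0))) ⟩
      (σ x y + β * σ x u) + α * (σ u y + β * + 0)
        ≡⟨ drop-zero (σ x y + β * σ x u) α (σ u y) β ⟩
      (σ x y + β * σ x u) + α * σ u y
        ≈⟨ +-cong-≋ (+-cong-≋ (σ≋M a≢j) (*-congˡ-≋ β (≋-trans (σ≋M a≢i) (M-symmetric a≢i))))
                    (*-congˡ-≋ α (σ≋M (j≢i ∘ ≡.sym))) ⟩
      (+ M a j + β * + M i a) + α * + M i j
        ≡⟨ absorb (+ M a j) (+ M i a) (+ M i j) α β (m-absorbs a≢i) (m-absorbs j≢i) ⟩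
      + M a j + α * β * (+ M i a + + M i j)
        ∎
      where
      x y : ℤ^ r
      x = E a
      y = E j
      α β : ℤ
      α = + m a
      β = + m j
      drop-zero : ∀ s α t β → s + α * (t + β * + 0) ≡ s + α * t
      drop-zero = solve-∀
      absorb : ∀ s p q α β → α * p ≡ p → β * q ≡ q → (s + β * p) + α * q ≡ s + α * β * (p + q)
      absorb s p q α β αp≡p βq≡q =
        ≡.trans (cong₂ (λ p′ q′ → (s + β * p′) + α * q′) (≡.sym αp≡p) (≡.sym βq≡q))
                (expand s p q α β)
        where
        expand : ∀ s p q α β → (s + β * (α * p)) + α * (β * q) ≡ s + α * β * (p + q)
        expand = solve-∀

    module _ {M′ : Fin r → Fin r → ℕ} (M′-represents : Represents κ h e′ M′) where
      module M′ = Represents M′-represents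

      τ-congruence : ∀ a j → + M′ a j ≋ τ n i (λ a b → + M a b) a j
      τ-congruence a j with a ≟ i | j ≟ i | a ≟ j
      ... | yes refl | yes refl | _        = begin
        + M′ i i                ≈⟨ M′.diag i ⟩
        + h + κ (e′ i) (e′ i)   ≈⟨ +-congˡ-≋ (+ h) κ-reflected-i ⟩
        + h + + h               ≈⟨ h+h≋0 ⟩
        + 0                     ∎
      ... | yes refl | no j≢i   | _        = ≋-trans (M′.offdiag (j≢i ∘ ≡.sym)) (σ-reflected-i j≢i)
      ... | no a≢i   | yes refl | _        = begin
        + M′ a i             ≈⟨ M′.offdiag a≢i ⟩
        σ (e′ a) (e′ i)      ≡⟨ symmetrise-comm κ (e′ a) (e′ i) ⟩
        σ (e′ i) (e′ a)      ≈⟨ σ-reflected-i a≢i ⟩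
        - + M i a            ≈⟨ neg-cong-≋ (M-symmetric (a≢i ∘ ≡.sym)) ⟩
        - + M a i            ∎
      ... | no a≢i   | no j≢i   | yes refl = begin
        + M′ a a                                           ≈⟨ M′.diag a ⟩
        + h + κ (e′ a) (e′ a)                              ≈⟨ κ-reflected-diag a≢i ⟩
        + M a a + + m a * (+ M i a + + h)                  ≡⟨ cong₂ (λ b c → + M a a + b * (+ M i a + + c))
                                                                     (m≡edge a a≢i) (≡.sym n/2≡h) ⟩
        + M a a + edge (+ M i a) * (+ M i a + + (n ℕ./ 2)) ∎
        where
        n/2≡h : n ℕ./ 2 ≡ h
        n/2≡h = ≡.trans (cong (ℕ._/ 2) (≡.trans n≡2h (ℕP.*-comm 2 h))) (m*n/n≡m h 2)
      ... | no a≢i   | no j≢i   | no a≢j   = begin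
        + M′ a j
          ≈⟨ M′.offdiag a≢j ⟩
        σ (e′ a) (e′ j)
          ≈⟨ σ-reflected-offdiag a≢i j≢i a≢j ⟩
        + M a j + + m a * + m j * (+ M i a + + M i j)
          ≡⟨ cong₂ (λ b c → + M a j + b * c * (+ M i a + + M i j)) (m≡edge a a≢i) (m≡edge j j≢i) ⟩
        + M a j + edge (+ M i a) * edge (+ M i j) * (+ M i a + + M i j)
          ∎

module _ {c ℓ : Level} (R : CommutativeRing c ℓ) where
  open CommutativeRing R
  open import Algebra.Properties.Semiring.Exp semiring using (_^_; ^-homo-*)
  open import Algebra.Properties.Ring ring using (x[y-z]≈xy-xz; -1*x≈-x)
  open import Algebra.Properties.Group +-group
    using (inverseˡ-unique; x∙y⁻¹≈ε⇒x≈y; x≈y⇒x∙y⁻¹≈ε; ⁻¹-involutive)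
  open import Algebra.Properties.Monoid *-monoid using (cancelˡ; insertˡ)
  open import Relation.Binary.Reasoning.Setoid setoid

  pow≡^ : ∀ x k → pow R x k ≡ x ^ k
  pow≡^ x zero    = ≡.refl
  pow≡^ x (suc k) = ≡.cong (x *_) (pow≡^ x k)

  pow-+ : ∀ x a b → pow R x (a ℕ.+ b) ≈ pow R x a * pow R x b
  pow-+ x a b rewrite pow≡^ x (a ℕ.+ b) | pow≡^ x a | pow≡^ x b = ^-homo-* x a b

  square≈1⇒≈-1⊎≈1 : NoZeroDivisors R → ∀ x → x * x ≈ 1# → x ≈ - 1# ⊎ x ≈ 1#
  square≈1⇒≈-1⊎≈1 noZeroDivisors x x²≈1 =
    Sum.map (inverseˡ-unique x 1#) (x∙y⁻¹≈ε⇒x≈y x 1#)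
            (noZeroDivisors (x + 1#) (x - 1#) difference-of-squares)
    where
    difference-of-squares : (x + 1#) * (x - 1#) ≈ 0#
    difference-of-squares = trans (x[y-z]≈xy-xz (x + 1#) x 1#) (x≈y⇒x∙y⁻¹≈ε (begin
      (x + 1#) * x    ≈⟨ distribʳ x x 1# ⟩
      x * x + 1# * x  ≈⟨ +-cong x²≈1 (*-identityˡ x) ⟩
      1# + x          ≈⟨ +-comm 1# x ⟩
      x + 1#          ≈⟨ *-identityʳ (x + 1#) ⟨
      (x + 1#) * 1#   ∎))

  module Order {ζ : Carrier} {n : ℕ} (order : HasOrder R ζ n) where
    open Modular n using (_≋_; ≋-sym; ∣∸⇒≋)

    private
      instance
        n≢0 : ℕ.NonZero n
        n≢0 = ℕ.>-nonZero (proj₁ order)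

    pow-multiple : ∀ q → pow R ζ (q ℕ.* n) ≈ 1#
    pow-multiple zero    = refl
    pow-multiple (suc q) = begin
      pow R ζ (n ℕ.+ q ℕ.* n)          ≈⟨ pow-+ ζ n (q ℕ.* n) ⟩
      pow R ζ n * pow R ζ (q ℕ.* n)    ≈⟨ *-cong (proj₁ (proj₂ order)) (pow-multiple q) ⟩
      1# * 1#                          ≈⟨ *-identityˡ 1# ⟩
      1#                               ∎

    pow-% : ∀ k → pow R ζ k ≈ pow R ζ (k % n)
    pow-% k = begin
      pow R ζ k                                   ≡⟨ ≡.cong (pow R ζ) (m≡m%n+[m/n]*n k n) ⟩
      pow R ζ (k % n ℕ.+ (k / n) ℕ.* n)           ≈⟨ pow-+ ζ (k % n) _ ⟩
      pow R ζ (k % n) * pow R ζ ((k / n) ℕ.* n)   ≈⟨ *-congˡ (pow-multiple (k / n)) ⟩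
      pow R ζ (k % n) * 1#                        ≈⟨ *-identityʳ _ ⟩
      pow R ζ (k % n)                             ∎

    pow≈1⇒∣ : ∀ d → pow R ζ d ≈ 1# → n ℕ∣ d
    pow≈1⇒∣ d ζᵈ≈1 with d % n in d%n≡k
    ... | zero  = m%n≡0⇒n∣m d n d%n≡k
    ... | suc k = contradiction ζ^[d%n]≈1
                    (proj₂ (proj₂ order) (suc k) z<s (≡.subst (ℕ._< n) d%n≡k (m%n<n d n)))
      where
      ζ^[d%n]≈1 : pow R ζ (suc k) ≈ 1#
      ζ^[d%n]≈1 = trans (reflexive (≡.cong (pow R ζ) (≡.sym d%n≡k))) (trans (sym (pow-% d)) ζᵈ≈1)

    pow-cancelˡ : ∀ a {x y} → pow R ζ a * x ≈ pow R ζ a * y → x ≈ y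
    pow-cancelˡ zero    {x} {y} eq = trans (sym (*-identityˡ x)) (trans eq (*-identityˡ y))
    pow-cancelˡ (suc a) {x} {y} eq = pow-cancelˡ a (begin
      pow R ζ a * x                        ≈⟨ insertˡ ζ⁻¹ζ≈1 _ ⟩
      ζ⁻¹ * (ζ * (pow R ζ a * x))  ≈⟨ *-congˡ (trans (sym (*-assoc ζ _ x)) (trans eq (*-assoc ζ _ y))) ⟩
      ζ⁻¹ * (ζ * (pow R ζ a * y))          ≈⟨ cancelˡ ζ⁻¹ζ≈1 _ ⟩
      pow R ζ a * y                        ∎)
      where
      ζ⁻¹ : Carrier
      ζ⁻¹ = pow R ζ (n ℕ.∸ 1)
      ζ⁻¹ζ≈1 : ζ⁻¹ * ζ ≈ 1#
      ζ⁻¹ζ≈1 = trans (*-comm ζ⁻¹ ζ)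
                     (trans (reflexive (≡.cong (pow R ζ) (ℕP.suc-pred n))) (proj₁ (proj₂ order)))

    pow≈pow⇒≋-≤ : ∀ {a b} → a ℕ.≤ b → pow R ζ a ≈ pow R ζ b → + b ≋ + a
    pow≈pow⇒≋-≤ {a} {b} a≤b ζᵃ≈ζᵇ = ∣∸⇒≋ a≤b (pow≈1⇒∣ (b ℕ.∸ a) (pow-cancelˡ a (begin
      pow R ζ a * pow R ζ (b ℕ.∸ a)   ≈⟨ pow-+ ζ a (b ℕ.∸ a) ⟨
      pow R ζ (a ℕ.+ (b ℕ.∸ a))       ≡⟨ ≡.cong (pow R ζ) (ℕP.m+[n∸m]≡n a≤b) ⟩
      pow R ζ b                       ≈⟨ ζᵃ≈ζᵇ ⟨
      pow R ζ a                       ≈⟨ *-identityʳ _ ⟨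
      pow R ζ a * 1#                  ∎)))

    pow-injective : ∀ {a b} → pow R ζ a ≈ pow R ζ b → + a ≋ + b
    pow-injective {a} {b} ζᵃ≈ζᵇ with ℕP.≤-total a b
    ... | inj₁ a≤b = ≋-sym (pow≈pow⇒≋-≤ a≤b ζᵃ≈ζᵇ)
    ... | inj₂ b≤a = pow≈pow⇒≋-≤ b≤a (sym ζᵃ≈ζᵇ)

    pow-half≉1 : ∀ h → n ≡ 2 ℕ.* h → ¬ pow R ζ h ≈ 1#
    pow-half≉1 zero    n≡0  = contradiction (≡.sym n≡0) (ℕP.<⇒≢ (proj₁ order))
    pow-half≉1 (suc k) n≡2h = proj₂ (proj₂ order) (suc k) z<s
      (≡.subst (suc k ℕ.<_) (≡.sym n≡2h) (ℕP.m<m+n (suc k) z<s))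

    pow-half≈-1 : NoZeroDivisors R → ∀ h → n ≡ 2 ℕ.* h → pow R ζ h ≈ - 1#
    pow-half≈-1 noZeroDivisors h n≡2h =
      Sum.[ id , flip contradiction (pow-half≉1 h n≡2h) ]′
        (square≈1⇒≈-1⊎≈1 noZeroDivisors (pow R ζ h) ζʰζʰ≈1)
      where
      h+h≡n : h ℕ.+ h ≡ n
      h+h≡n = ≡.trans (≡.cong (h ℕ.+_) (≡.sym (ℕP.+-identityʳ h))) (≡.sym n≡2h)

      ζʰζʰ≈1 : pow R ζ h * pow R ζ h ≈ 1#
      ζʰζʰ≈1 = trans (sym (pow-+ ζ h h))
                     (trans (reflexive (≡.cong (pow R ζ) h+h≡n)) (proj₁ (proj₂ order)))

  Is-M-diag : ∀ {r} (ψ : ℤ^ r → ℤ^ r → Carrier) (ζ : Carrier) {E′ M′} → Is-M R ψ E′ ζ M′ →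
              ∀ j → IsLeast (λ t → pow R ζ t ≈ - ψ (E′ j) (E′ j)) (M′ j j)
  Is-M-diag ψ ζ is-M j with j ≟ j | is-M j j
  ... | yes _  | least = least
  ... | no j≢j | _     = contradiction ≡.refl j≢j

  Is-M-offdiag : ∀ {r} (ψ : ℤ^ r → ℤ^ r → Carrier) (ζ : Carrier) {E′ M′} → Is-M R ψ E′ ζ M′ →
                 ∀ {j k} → j ≢ k →
                 IsLeast (λ t → pow R ζ t ≈ ψ (E′ j) (E′ k) * ψ (E′ k) (E′ j)) (M′ j k)
  Is-M-offdiag ψ ζ is-M {j} {k} j≢k with j ≟ k | is-M j k
  ... | yes j≡k | _     = contradiction j≡k j≢k
  ... | no _    | least = least

  module DiscreteLog (noZeroDivisors : NoZeroDivisors R) {ζ : Carrier} {n : ℕ} (order : HasOrder R ζ n)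
                     (h : ℕ) (n≡2h : n ≡ 2 ℕ.* h)
                     {r : ℕ} (ψ : ℤ^ r → ℤ^ r → Carrier) (bicharacter : IsBicharacter R ψ)
                     (ψ∈⟨ζ⟩ : ∀ x y → Σ ℕ λ k → ψ x y ≈ pow R ζ k) where
    open Order order
    open Modular n

    log : ℤ^ r → ℤ^ r → ℕ
    log x y = proj₁ (ψ∈⟨ζ⟩ x y)

    κ : ℤ^ r → ℤ^ r → ℤ
    κ x y = + log x y

    ψ≈ζ^log : ∀ x y → ψ x y ≈ pow R ζ (log x y)
    ψ≈ζ^log x y = proj₂ (ψ∈⟨ζ⟩ x y)

    pow≈ψ*ψ⇒≋ : ∀ {k x₁ y₁ x₂ y₂} → pow R ζ k ≈ ψ x₁ y₁ * ψ x₂ y₂ → + k ≋ κ x₁ y₁ ℤ.+ κ x₂ y₂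
    pow≈ψ*ψ⇒≋ {k} {x₁} {y₁} {x₂} {y₂} ζᵏ≈ψψ = pow-injective (begin
      pow R ζ k                                  ≈⟨ ζᵏ≈ψψ ⟩
      ψ x₁ y₁ * ψ x₂ y₂                          ≈⟨ *-cong (ψ≈ζ^log x₁ y₁) (ψ≈ζ^log x₂ y₂) ⟩
      pow R ζ (log x₁ y₁) * pow R ζ (log x₂ y₂)  ≈⟨ pow-+ ζ (log x₁ y₁) (log x₂ y₂) ⟨
      pow R ζ (log x₁ y₁ ℕ.+ log x₂ y₂)          ∎)

    κ-bilinear : Bilinear κ
    κ-bilinear = (λ z x y → pow≈ψ*ψ⇒≋ (trans (sym (ψ≈ζ^log _ _)) (proj₁ bicharacter x y z)))
               , (λ x y z → pow≈ψ*ψ⇒≋ (trans (sym (ψ≈ζ^log _ _)) (proj₂ bicharacter x y z)))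

    ζʰ≈-1 : pow R ζ h ≈ - 1#
    ζʰ≈-1 = pow-half≈-1 noZeroDivisors h n≡2h

    ψ≈-1⇒κ≋h : ∀ {x} → ψ x x ≈ - 1# → κ x x ≋ + h
    ψ≈-1⇒κ≋h {x} ψ≈-1 = pow-injective (trans (sym (ψ≈ζ^log x x)) (trans ψ≈-1 (sym ζʰ≈-1)))

    M-diag≋ : ∀ {E′ M′} → Is-M R ψ E′ ζ M′ → ∀ j → + M′ j j ≋ + h ℤ.+ κ (E′ j) (E′ j)
    M-diag≋ {E′} {M′} is-M j = pow-injective (begin
      pow R ζ (M′ j j)                  ≈⟨ proj₁ (Is-M-diag ψ ζ is-M j) ⟩
      - ψ (E′ j) (E′ j)                 ≈⟨ -1*x≈-x _ ⟨
      - 1# * ψ (E′ j) (E′ j)            ≈⟨ *-cong (sym ζʰ≈-1) (ψ≈ζ^log _ _) ⟩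
      pow R ζ h * pow R ζ (log (E′ j) (E′ j)) ≈⟨ pow-+ ζ h (log (E′ j) (E′ j)) ⟨
      pow R ζ (h ℕ.+ log (E′ j) (E′ j)) ∎)

    M-offdiag≋ : ∀ {E′ M′} → Is-M R ψ E′ ζ M′ →
                 ∀ {j k} → j ≢ k → + M′ j k ≋ symmetrise κ (E′ j) (E′ k)
    M-offdiag≋ is-M j≢k = pow≈ψ*ψ⇒≋ (proj₁ (Is-M-offdiag ψ ζ is-M j≢k))

    Is-M⇒Represents : ∀ {E′ M′} → Is-M R ψ E′ ζ M′ → Represents κ h E′ M′
    Is-M⇒Represents is-M = record { diag = M-diag≋ is-M ; offdiag = M-offdiag≋ is-M }

  module ReflectionCoefficients (noZeroDivisors : NoZeroDivisors R) {ζ : Carrier} {n : ℕ} (order : HasOrder R ζ n)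
                      (h : ℕ) (n≡2h : n ≡ 2 ℕ.* h) {r : ℕ} (ψ : ℤ^ r → ℤ^ r → Carrier)
                      (E : Fin r → ℤ^ r) (i : Fin r) (ψᵢᵢ≈-1 : ψ (E i) (E i) ≈ - 1#)
                      {M : Fin r → Fin r → ℕ} (is-M : Is-M R ψ E ζ M)
                      {m : Fin r → ℕ} (is-m : ∀ j → j ≢ i → Is-m R ψ E i j (m j)) where
    open Order order

    ψᵢᵢ≉1 : ¬ ψ (E i) (E i) ≈ 1#
    ψᵢᵢ≉1 ψᵢᵢ≈1 =
      pow-half≉1 h n≡2h (trans (pow-half≈-1 noZeroDivisors h n≡2h) (trans (sym ψᵢᵢ≈-1) ψᵢᵢ≈1))

    ψᵢᵢ²≈1 : ψ (E i) (E i) * ψ (E i) (E i) ≈ 1#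
    ψᵢᵢ²≈1 = begin
      ψ (E i) (E i) * ψ (E i) (E i)  ≈⟨ *-cong ψᵢᵢ≈-1 ψᵢᵢ≈-1 ⟩
      - 1# * - 1#                    ≈⟨ -1*x≈-x (- 1#) ⟩
      - - 1#                         ≈⟨ ⁻¹-involutive 1# ⟩
      1#                             ∎

    m-values : ∀ j → j ≢ i → (M i j ≡ 0 → m j ≡ 0) × (M i j ≢ 0 → m j ≡ 1)
    m-values j j≢i = m≡0 , m≡1
      where
      Mᵢⱼ-least : IsLeast (λ t → pow R ζ t ≈ ψ (E i) (E j) * ψ (E j) (E i)) (M i j)
      Mᵢⱼ-least = Is-M-offdiag ψ ζ is-M (j≢i ∘ ≡.sym)

      m≡0 : M i j ≡ 0 → m j ≡ 0
      m≡0 Mᵢⱼ≡0 = IsLeast-zero (is-m j j≢i) (inj₂ ψψ≈1)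
        where
        ψψ≈1 : 1# * (ψ (E i) (E j) * ψ (E j) (E i)) ≈ 1#
        ψψ≈1 = trans (*-identityˡ _) (sym (≡.subst (λ t → pow R ζ t ≈ _) Mᵢⱼ≡0 (proj₁ Mᵢⱼ-least)))

      m≡1 : M i j ≢ 0 → m j ≡ 1
      m≡1 Mᵢⱼ≢0 = IsLeast-one (is-m j j≢i)
        Sum.[ ψᵢᵢ≉1 ∘ trans (sym (*-identityʳ _)) , ψψ≉1 ]′
        (inj₁ (trans (*-congˡ (*-identityʳ _)) ψᵢᵢ²≈1))
        where
        ψψ≉1 : ¬ 1# * (ψ (E i) (E j) * ψ (E j) (E i)) ≈ 1#
        ψψ≉1 ψψ≈1 = proj₂ Mᵢⱼ-least 0 (ℕP.n≢0⇒n>0 Mᵢⱼ≢0) (sym (trans (sym (*-identityˡ _)) ψψ≈1))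

    m≡edge : ∀ j → j ≢ i → + m j ≡ edge (+ M i j)
    m≡edge j j≢i with M i j | m-values j j≢i
    ... | zero  | m≡0 , _ = ≡.cong +_ (m≡0 ≡.refl)
    ... | suc _ | _ , m≡1 = ≡.cong +_ (m≡1 (λ ()))

lemma5p17 : ∀ {c ℓ : Level} (R : CommutativeRing c ℓ) → NoZeroDivisors R →
    let open CommutativeRing R in
    ∀ {r : ℕ} (ψ : ℤ^ r → ℤ^ r → Carrier) → IsBicharacter R ψ →
    (E : Fin r → ℤ^ r) → IsBasis E →
    (ζ : Carrier) (n : ℕ) → HasOrder R ζ n → (Σ ℕ λ h → n ≡ 2 Data.Nat.* h) →
    (∀ x y → Σ ℕ λ k → ψ x y ≈ pow R ζ k) →
    (i : Fin r) → ψ (E i) (E i) ≈ - 1# →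
    (M : Fin r → Fin r → ℕ) → Is-M R ψ E ζ M →
    (m : Fin r → ℕ) → (∀ j → j ≢ i → Is-m R ψ E i j (m j)) →
    (∀ j → j ≢ i → (M i j ≡ 0 → m j ≡ 0) × (M i j ≢ 0 → m j ≡ 1)) ×
    (∀ (M' : Fin r → Fin r → ℕ) → Is-M R ψ (s-basis i m E) ζ M' →
    ∀ h j → (+ M' h j) ≡ τ n i (λ a b → + M a b) h j [mod n ])
lemma5p17 R noZeroDivisors ψ bicharacter E _ ζ n order (h , n≡2h) ψ∈⟨ζ⟩ i ψᵢᵢ≈-1 M is-M m is-m =
  m-values , λ M′ is-M′ a j → ≋⇒≡[mod] (τ-congruence (Is-M⇒Represents is-M′) a j)
  where
  open Modular n using (≋⇒≡[mod]; module Reflection)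
  open DiscreteLog R noZeroDivisors order h n≡2h ψ bicharacter ψ∈⟨ζ⟩
    using (κ-bilinear; ψ≈-1⇒κ≋h; Is-M⇒Represents)
  open ReflectionCoefficients R noZeroDivisors order h n≡2h ψ E i ψᵢᵢ≈-1 is-M is-m using (m-values; m≡edge)
  open Reflection κ-bilinear h n≡2h E i (ψ≈-1⇒κ≋h ψᵢᵢ≈-1) (Is-M⇒Represents is-M) m≡edge
    using (τ-congruence)
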